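{- Let $\Gamma$ be a locally finite graph and let $\Delta=\Gamma\sqcup\Sigma_{V(\Gamma)}$ be the graph obtained from $\Gamma$ by adding one loop (fixed by the involution) at every vertex. Fix a vertex $v$, and let $g(t)$ and $e(t)$ be the circuit series at $v$ of $\Gamma$ and of $\Delta$ respectively. Then $$e(t)=\frac{1}{1-t}\,g\left(\frac{t}{1-t}\right).$$
   Context: A graph has vertices $V$, edges $E$, maps $\alpha,\omega:E\to V$ and an involution $e\mapsto\overline e$ with $\overline e^\alpha=e^\omega$. The stationing graph $\Sigma_S$ on a set $S$ has vertex set and edge set $S$ with $s^\alpha=s^\omega=\overline s=s$. The circuit series at $v$ is $\sum_\pi t^{|\pi|}$ over all circuits (sequences of consecutive edges from $v$ to $v$, including the empty one). -}

module Defs where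

open import Data.Nat using (ℕ; zero; suc; _+_; _*_; _∸_)
open import Data.Sum using (_⊎_; inj₁; inj₂)
open import Data.Product using (Σ)
open import Data.List using (List)
open import Data.List.Membership.Propositional using (_∈_)
open import Relation.Binary.PropositionalEquality using (_≡_; refl)

record Graph : Set₁ where
  field
    V     : Set
    E     : Set
    α     : E → V
    ω     : E → V
    bar   : E → E
    bar-invol : ∀ e → bar (bar e) ≡ e
    bar-α     : ∀ e → α (bar e) ≡ ω e

open Graph public

LocallyFinite : Graph → Set
LocallyFinite Γ = ∀ (v : V Γ) → Σ (List (E Γ)) (λ l → ∀ (e : E Γ) → α Γ e ≡ v → e ∈ l)

module _ (Γ : Graph) where
  private
    αΔ : E Γ ⊎ V Γ → V Γ
    αΔ (inj₁ e) = α Γ e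
    αΔ (inj₂ v) = v
    ωΔ : E Γ ⊎ V Γ → V Γ
    ωΔ (inj₁ e) = ω Γ e
    ωΔ (inj₂ v) = v
    barΔ : E Γ ⊎ V Γ → E Γ ⊎ V Γ
    barΔ (inj₁ e) = inj₁ (bar Γ e)
    barΔ (inj₂ v) = inj₂ v
    invΔ : ∀ x → barΔ (barΔ x) ≡ x
    invΔ (inj₁ e) rewrite bar-invol Γ e = refl
    invΔ (inj₂ v) = refl
    bαΔ : ∀ x → αΔ (barΔ x) ≡ ωΔ x
    bαΔ (inj₁ e) = bar-α Γ e
    bαΔ (inj₂ v) = refl

  addLoops : Graph
  addLoops = record
    { V = V Γ ; E = E Γ ⊎ V Γ ; α = αΔ ; ω = ωΔ ; bar = barΔ
    ; bar-invol = invΔ ; bar-α = bαΔ }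

data Path (Γ : Graph) : V Γ → V Γ → ℕ → Set where
  nil  : ∀ {u} → Path Γ u u 0
  step : ∀ {u w n} (e : E Γ) → α Γ e ≡ u → Path Γ (ω Γ e) w n → Path Γ u w (suc n)

Circuit : (Γ : Graph) → V Γ → ℕ → Set
Circuit Γ v n = Path Γ v v n

PowerSeries : Set
PowerSeries = ℕ → ℕ

sumUpTo : ℕ → (ℕ → ℕ) → ℕ
sumUpTo zero    f = f 0
sumUpTo (suc n) f = sumUpTo n f + f (suc n)

oneS : PowerSeries
oneS zero    = 1
oneS (suc _) = 0

_⋆_ : PowerSeries → PowerSeries → PowerSeries
(a ⋆ b) n = sumUpTo n (λ k → a k * b (n ∸ k))

powS : PowerSeries → ℕ → PowerSeries
powS h zero    = oneS
powS h (suc k) = h ⋆ powS h k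

-- Composition g(h(t)) for h with zero constant term:
-- coefficient n is Σ_{k ≤ n} g_k [t^n] h^k  (h^k has no terms below t^k).
compose : PowerSeries → PowerSeries → PowerSeries
compose g h n = sumUpTo n (λ k → g k * powS h k n)

-- 1/(1-t) = 1 + t + t² + ...
geomS : PowerSeries
geomS _ = 1

tOver1-t : PowerSeries
tOver1-t zero    = 0
tOver1-t (suc _) = 1

-- A walk of length n in Δ is a walk of some length k in Γ with n ∸ k loops shuffled in, and
-- there are C(n,k) ways to place the loops; hence e_n = Σ_k C(n,k) g_k.  On the other side,
-- [t^n] (1/(1-t)) g(t/(1-t)) = Σ_k g_k Σ_{m≤n} [t^m] (t/(1-t))^k, and since
-- (t/(1-t))^(k+1) = t · (t/(1-t))^k / (1-t), these inner partial sums obey Pascal's rule,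
-- so they are C(n,k) too.
module Submission where

open import Defs
open import Data.Nat using (ℕ; zero; suc; _+_; _*_; _∸_; _≤_; _<_; z≤n; s≤s)
open import Data.Nat.Properties
open import Data.Nat.Combinatorics using (_C_; nCk+nC[k+1]≡[n+1]C[k+1])
open import Data.Fin using (Fin; zero)
open import Data.Fin.Properties using (+↔⊎; *↔×)
open import Data.Fin.Permutation using (↔⇒≡)
open import Data.Product using (Σ; _×_; _,_)
open import Data.Product.Function.NonDependent.Propositional using (_×-↔_)
open import Data.Sum using (_⊎_; inj₁; inj₂; [_,_])
open import Data.Sum.Function.Propositional using (_⊎-↔_)
open import Function.Bundles using (_↔_; mk↔ₛ′)
open import Function.Properties.Inverse using (↔-sym; ↔-trans)
open import Function.Related.Propositional using (module EquationalReasoning)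
open import Algebra.Properties.CommutativeSemigroup +-commutativeSemigroup using (interchange)
open import Relation.Binary.PropositionalEquality
  using (_≡_; refl; sym; trans; cong; cong₂; module ≡-Reasoning)

sumUpTo-cong : ∀ n {f f′ : ℕ → ℕ} → (∀ k → f k ≡ f′ k) → sumUpTo n f ≡ sumUpTo n f′
sumUpTo-cong zero    f≗f′ = f≗f′ 0
sumUpTo-cong (suc n) f≗f′ = cong₂ _+_ (sumUpTo-cong n f≗f′) (f≗f′ (suc n))

sumUpTo-suc : ∀ n (f : ℕ → ℕ) → sumUpTo (suc n) f ≡ f 0 + sumUpTo n (λ k → f (suc k))
sumUpTo-suc zero    f = refl
sumUpTo-suc (suc n) f = begin
  sumUpTo (suc n) f + f (2 + n)                         ≡⟨ cong (_+ f (2 + n)) (sumUpTo-suc n f) ⟩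
  f 0 + sumUpTo n (λ k → f (suc k)) + f (2 + n)         ≡⟨ +-assoc (f 0) _ _ ⟩
  f 0 + sumUpTo (suc n) (λ k → f (suc k))               ∎
  where open ≡-Reasoning

sumUpTo-reverse : ∀ n (f : ℕ → ℕ) → sumUpTo n (λ k → f (n ∸ k)) ≡ sumUpTo n f
sumUpTo-reverse zero    f = refl
sumUpTo-reverse (suc n) f = begin
  sumUpTo (suc n) (λ k → f (suc n ∸ k))   ≡⟨ sumUpTo-suc n _ ⟩
  f (suc n) + sumUpTo n (λ k → f (n ∸ k)) ≡⟨ cong (f (suc n) +_) (sumUpTo-reverse n f) ⟩
  f (suc n) + sumUpTo n f                 ≡⟨ +-comm (f (suc n)) _ ⟩
  sumUpTo (suc n) f                       ∎
  where open ≡-Reasoning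

sumUpTo-distrib-+ : ∀ n (f f′ : ℕ → ℕ) →
                    sumUpTo n (λ k → f k + f′ k) ≡ sumUpTo n f + sumUpTo n f′
sumUpTo-distrib-+ zero    f f′ = refl
sumUpTo-distrib-+ (suc n) f f′ = begin
  sumUpTo n (λ k → f k + f′ k) + (f (suc n) + f′ (suc n))
    ≡⟨ cong (_+ (f (suc n) + f′ (suc n))) (sumUpTo-distrib-+ n f f′) ⟩
  (sumUpTo n f + sumUpTo n f′) + (f (suc n) + f′ (suc n))
    ≡⟨ interchange (sumUpTo n f) _ _ _ ⟩
  sumUpTo (suc n) f + sumUpTo (suc n) f′
    ∎
  where open ≡-Reasoning

sumUpTo-≡0 : ∀ n (f : ℕ → ℕ) → (∀ k → k ≤ n → f k ≡ 0) → sumUpTo n f ≡ 0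
sumUpTo-≡0 zero    f f≡0 = f≡0 0 z≤n
sumUpTo-≡0 (suc n) f f≡0 =
  cong₂ _+_ (sumUpTo-≡0 n f (λ k k≤n → f≡0 k (m≤n⇒m≤1+n k≤n))) (f≡0 (suc n) ≤-refl)

geomS-⋆ : ∀ (a : PowerSeries) n → (geomS ⋆ a) n ≡ sumUpTo n a
geomS-⋆ a n = begin
  sumUpTo n (λ k → 1 * a (n ∸ k)) ≡⟨ sumUpTo-cong n (λ k → *-identityˡ (a (n ∸ k))) ⟩
  sumUpTo n (λ k → a (n ∸ k))     ≡⟨ sumUpTo-reverse n a ⟩
  sumUpTo n a                     ∎
  where open ≡-Reasoning

module _ {h : PowerSeries} (h₀≡0 : h 0 ≡ 0) where

  powS≡0-below : ∀ k m → m < k → powS h k m ≡ 0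
  powS≡0-below (suc k) m m<1+k = sumUpTo-≡0 m _ term≡0
    where
    term≡0 : ∀ j → j ≤ m → h j * powS h k (m ∸ j) ≡ 0
    term≡0 zero    _   = cong (_* powS h k m) h₀≡0
    term≡0 (suc j) j<m = trans (cong (h (suc j) *_) (powS≡0-below k (m ∸ suc j) m∸1+j<k))
                               (*-zeroʳ (h (suc j)))
      where
      m∸1+j<k : m ∸ suc j < k
      m∸1+j<k = <-≤-trans (∸-monoʳ-< (s≤s z≤n) j<m) (≤-pred m<1+k)

  -- An exchange of summation order, legitimate because [t^m] h^k = 0 for m < k.
  sumUpTo-compose : ∀ g n →
    sumUpTo n (compose g h) ≡ sumUpTo n (λ k → g k * sumUpTo n (powS h k))
  sumUpTo-compose g zero    = refl
  sumUpTo-compose g (suc n) = begin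
    sumUpTo n (compose g h) + compose g h (suc n)
      ≡⟨ cong (_+ compose g h (suc n)) (trans (sumUpTo-compose g n) extend) ⟩
    sumUpTo (suc n) (λ k → g k * S k n) + compose g h (suc n)
      ≡⟨ sumUpTo-distrib-+ (suc n) _ _ ⟨
    sumUpTo (suc n) (λ k → g k * S k n + g k * powS h k (suc n))
      ≡⟨ sumUpTo-cong (suc n) (λ k → *-distribˡ-+ (g k) (S k n) _) ⟨
    sumUpTo (suc n) (λ k → g k * S k (suc n))
      ∎
    where
    open ≡-Reasoning
    S : ℕ → ℕ → ℕ
    S k m = sumUpTo m (powS h k)
    extend : sumUpTo n (λ k → g k * S k n) ≡ sumUpTo (suc n) (λ k → g k * S k n)
    extend = sym (trans (cong (sumUpTo n (λ k → g k * S k n) +_) last≡0) (+-identityʳ _))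
      where
      last≡0 : g (suc n) * S (suc n) n ≡ 0
      last≡0 = trans (cong (g (suc n) *_) (sumUpTo-≡0 n _ (λ m m≤n → powS≡0-below (suc n) m (s≤s m≤n))))
                     (*-zeroʳ (g (suc n)))

powS-tOver1-t-suc : ∀ k m → powS tOver1-t (suc k) (suc m) ≡ sumUpTo m (powS tOver1-t k)
powS-tOver1-t-suc k m = begin
  sumUpTo (suc m) (λ j → tOver1-t j * powS tOver1-t k (suc m ∸ j)) ≡⟨ sumUpTo-suc m _ ⟩
  sumUpTo m (λ j → 1 * powS tOver1-t k (m ∸ j))                   ≡⟨ geomS-⋆ (powS tOver1-t k) m ⟩
  sumUpTo m (powS tOver1-t k)                                      ∎
  where open ≡-Reasoning

sumUpTo-powS-tOver1-t : ∀ k n → sumUpTo n (powS tOver1-t k) ≡ n C k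
sumUpTo-powS-tOver1-t zero    zero    = refl
sumUpTo-powS-tOver1-t zero    (suc n) = trans (+-identityʳ _) (sumUpTo-powS-tOver1-t zero n)
sumUpTo-powS-tOver1-t (suc k) zero    = refl
sumUpTo-powS-tOver1-t (suc k) (suc n) = begin
  sumUpTo n (powS tOver1-t (suc k)) + powS tOver1-t (suc k) (suc n)
    ≡⟨ cong₂ _+_ (sumUpTo-powS-tOver1-t (suc k) n)
                 (trans (powS-tOver1-t-suc k n) (sumUpTo-powS-tOver1-t k n)) ⟩
  n C suc k + n C k
    ≡⟨ +-comm (n C suc k) _ ⟩
  n C k + n C suc k
    ≡⟨ nCk+nC[k+1]≡[n+1]C[k+1] n k ⟩
  suc n C suc k
    ∎
  where open ≡-Reasoning

geomS⋆compose-tOver1-t : ∀ g n → (geomS ⋆ compose g tOver1-t) n ≡ sumUpTo n (λ k → g k * (n C k))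
geomS⋆compose-tOver1-t g n = begin
  (geomS ⋆ compose g tOver1-t) n
    ≡⟨ geomS-⋆ (compose g tOver1-t) n ⟩
  sumUpTo n (compose g tOver1-t)
    ≡⟨ sumUpTo-compose refl g n ⟩
  sumUpTo n (λ k → g k * sumUpTo n (powS tOver1-t k))
    ≡⟨ sumUpTo-cong n (λ k → cong (g k *_) (sumUpTo-powS-tOver1-t k n)) ⟩
  sumUpTo n (λ k → g k * (n C k))
    ∎
  where open ≡-Reasoning

data Shuffle : ℕ → ℕ → Set where
  []   : Shuffle 0 0
  loop : ∀ {n k} → Shuffle n k → Shuffle (suc n) k
  edge : ∀ {n k} → Shuffle n k → Shuffle (suc n) (suc k)

Shuffle⇒≤ : ∀ {n k} → Shuffle n k → k ≤ n
Shuffle⇒≤ []       = z≤n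
Shuffle⇒≤ (loop s) = m≤n⇒m≤1+n (Shuffle⇒≤ s)
Shuffle⇒≤ (edge s) = s≤s (Shuffle⇒≤ s)

Shuffle↔Fin-C : ∀ n k → Shuffle n k ↔ Fin (n C k)
Shuffle↔Fin-C zero    zero    = mk↔ₛ′ (λ _ → zero) (λ _ → []) (λ { zero → refl }) (λ { [] → refl })
Shuffle↔Fin-C zero    (suc k) = mk↔ₛ′ (λ ()) (λ ()) (λ ()) (λ ())
Shuffle↔Fin-C (suc n) zero    =
  ↔-trans (mk↔ₛ′ (λ { (loop s) → s }) loop (λ _ → refl) (λ { (loop s) → refl }))
          (Shuffle↔Fin-C n zero)
Shuffle↔Fin-C (suc n) (suc k) = begin
  Shuffle (suc n) (suc k)              ↔⟨ split↔ ⟩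
  (Shuffle n (suc k) ⊎ Shuffle n k)    ↔⟨ Shuffle↔Fin-C n (suc k) ⊎-↔ Shuffle↔Fin-C n k ⟩
  (Fin (n C suc k) ⊎ Fin (n C k))      ↔⟨ +↔⊎ ⟨
  Fin (n C suc k + n C k)              ≡⟨ cong Fin (+-comm (n C suc k) (n C k)) ⟩
  Fin (n C k + n C suc k)              ≡⟨ cong Fin (nCk+nC[k+1]≡[n+1]C[k+1] n k) ⟩
  Fin (suc n C suc k)                  ∎
  where
  open EquationalReasoning
  split : Shuffle (suc n) (suc k) → Shuffle n (suc k) ⊎ Shuffle n k
  split (loop s) = inj₁ s
  split (edge s) = inj₂ s
  split-inverse : ∀ s → [ loop , edge ] (split s) ≡ s
  split-inverse (loop s) = refl
  split-inverse (edge s) = refl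
  split↔ : Shuffle (suc n) (suc k) ↔ (Shuffle n (suc k) ⊎ Shuffle n k)
  split↔ = mk↔ₛ′ split [ loop , edge ] [ (λ _ → refl) , (λ _ → refl) ] split-inverse

module _ {Γ : Graph} where

  interleave : ∀ {u w n k} → Path Γ u w k → Shuffle n k → Path (addLoops Γ) u w n
  interleave {u} p           (loop s) = step (inj₂ u) refl (interleave p s)
  interleave nil             []       = nil
  interleave (step e refl p) (edge s) = step (inj₁ e) refl (interleave p s)

  private
    consEdge : ∀ {w n} e → Σ ℕ (λ k → Path Γ (ω Γ e) w k × Shuffle n k)
             → Σ ℕ (λ k → Path Γ (α Γ e) w k × Shuffle (suc n) k)
    consEdge e (k , p , s) = suc k , step e refl p , edge s

    consLoop : ∀ {u w n} → Σ ℕ (λ k → Path Γ u w k × Shuffle n k)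
             → Σ ℕ (λ k → Path Γ u w k × Shuffle (suc n) k)
    consLoop (k , p , s) = k , p , loop s

  separate : ∀ {u w n} → Path (addLoops Γ) u w n → Σ ℕ (λ k → Path Γ u w k × Shuffle n k)
  separate nil                    = 0 , nil , []
  separate (step (inj₁ e) refl p) = consEdge e (separate p)
  separate (step (inj₂ _) refl p) = consLoop (separate p)

  separate-interleave : ∀ {u w n k} (p : Path Γ u w k) (s : Shuffle n k) →
                        separate (interleave p s) ≡ (k , p , s)
  separate-interleave p               (loop s) = cong consLoop (separate-interleave p s)
  separate-interleave nil             []       = refl
  separate-interleave (step e refl p) (edge s) = cong (consEdge e) (separate-interleave p s)

  interleave-separate : ∀ {u w n} (p : Path (addLoops Γ) u w n) →
                        let (k , q , s) = separate p in interleave q s ≡ p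
  interleave-separate nil                    = refl
  interleave-separate (step (inj₁ e) refl p) = cong (step (inj₁ e) refl) (interleave-separate p)
  interleave-separate (step (inj₂ _) refl p) = cong (step (inj₂ _) refl) (interleave-separate p)

  Path-addLoops↔ : ∀ {u w n} → Path (addLoops Γ) u w n ↔ Σ ℕ (λ k → Path Γ u w k × Shuffle n k)
  Path-addLoops↔ = mk↔ₛ′ separate (λ (k , p , s) → interleave p s)
                     (λ (k , p , s) → separate-interleave p s) interleave-separate

Σℕ↔⊎ : (B : ℕ → Set) → Σ ℕ B ↔ (B 0 ⊎ Σ ℕ (λ k → B (suc k)))
Σℕ↔⊎ B = mk↔ₛ′ to from
  (λ { (inj₁ x) → refl ; (inj₂ (k , x)) → refl })
  (λ { (zero , x) → refl ; (suc k , x) → refl })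
  where
  to : Σ ℕ B → B 0 ⊎ Σ ℕ (λ k → B (suc k))
  to (zero  , x) = inj₁ x
  to (suc k , x) = inj₂ (k , x)
  from : B 0 ⊎ Σ ℕ (λ k → B (suc k)) → Σ ℕ B
  from (inj₁ x)       = 0 , x
  from (inj₂ (k , x)) = suc k , x

Σ-bounded↔Fin-sumUpTo : ∀ n {B : ℕ → Set} (b : ℕ → ℕ) → (∀ {k} → B k → k ≤ n) →
                        (∀ k → B k ↔ Fin (b k)) → Σ ℕ B ↔ Fin (sumUpTo n b)
Σ-bounded↔Fin-sumUpTo zero {B} b bounded B↔b =
  ↔-trans (mk↔ₛ′ to (0 ,_) (λ _ → refl) from-to) (B↔b 0)
  where
  to : Σ ℕ B → B 0
  to (zero  , x) = x
  to (suc k , x) with () ← bounded x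
  from-to : ∀ y → (0 , to y) ≡ y
  from-to (zero  , x) = refl
  from-to (suc k , x) with () ← bounded x
Σ-bounded↔Fin-sumUpTo (suc n) {B} b bounded B↔b = begin
  Σ ℕ B
    ↔⟨ Σℕ↔⊎ B ⟩
  (B 0 ⊎ Σ ℕ (λ k → B (suc k)))
    ↔⟨ B↔b 0 ⊎-↔ Σ-bounded↔Fin-sumUpTo n (λ k → b (suc k)) (λ x → ≤-pred (bounded x))
                                      (λ k → B↔b (suc k)) ⟩
  (Fin (b 0) ⊎ Fin (sumUpTo n (λ k → b (suc k))))
    ↔⟨ +↔⊎ ⟨
  Fin (b 0 + sumUpTo n (λ k → b (suc k)))
    ≡⟨ cong Fin (sumUpTo-suc n b) ⟨
  Fin (sumUpTo (suc n) b)
    ∎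
  where open EquationalReasoning

Path-addLoops↔Fin : ∀ {Γ : Graph} {u w} (a : PowerSeries) → (∀ k → Path Γ u w k ↔ Fin (a k)) →
                    ∀ n → Path (addLoops Γ) u w n ↔ Fin (sumUpTo n (λ k → a k * (n C k)))
Path-addLoops↔Fin a paths n = ↔-trans Path-addLoops↔
  (Σ-bounded↔Fin-sumUpTo n _ (λ (_ , s) → Shuffle⇒≤ s)
    (λ k → ↔-trans (paths k ×-↔ Shuffle↔Fin-C n k) (↔-sym *↔×)))

mainTheorem15 : (Γ : Graph) → LocallyFinite Γ → (v : V Γ)
    → (g e : PowerSeries)
    → (∀ n → Circuit Γ v n ↔ Fin (g n))
    → (∀ n → Circuit (addLoops Γ) v n ↔ Fin (e n))
    → ∀ n → e n ≡ (geomS ⋆ compose g tOver1-t) n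
mainTheorem15 _ _ _ g e circuitsΓ circuitsΔ n = begin
  e n                               ≡⟨ ↔⇒≡ (↔-trans (↔-sym (circuitsΔ n)) (Path-addLoops↔Fin g circuitsΓ n)) ⟩
  sumUpTo n (λ k → g k * (n C k))   ≡⟨ geomS⋆compose-tOver1-t g n ⟨
  (geomS ⋆ compose g tOver1-t) n    ∎
  where open ≡-Reasoning
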